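{- Let $0<\alpha<1$, let $h$ be an integer and let $B$ be a non-empty finite set of integers. If $|B\cap(B+h)|>(1-\alpha)|B|$, then $B$ contains an arithmetic progression of length $\lfloor 1/\alpha\rfloor+1$ and difference $h$, i.e. there is $b\in B$ with $b+jh\in B$ for all $0\le j\le \lfloor 1/\alpha\rfloor$.
   Context: $B+h=\{x+h : x\in B\}$.
   Formalization: The parameter α ranges over the rationals. -}

module Defs where

open import Data.Nat using (ℕ)
open import Data.Integer as ℤ using (ℤ; _-_; _≟_)
open import Data.Rational as ℚ using (ℚ; 0ℚ; _<_; 1/_; floor; positive)
open import Data.Rational.Properties using (pos⇒nonZero)
open import Data.List using (List; filter; length)
open import Data.List.Membership.DecPropositional _≟_ using (_∈?_)

floorInv : (α : ℚ) → 0ℚ < α → ℤ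
floorInv α 0<α = floor (1/_ α {{pos⇒nonZero α {{positive 0<α}}}})

-- The list of elements of B ∩ (B + h) = { x ∈ B : x - h ∈ B }.
-- For B duplicate-free, its length is |B ∩ (B + h)|.
inter-shift : List ℤ → ℤ → List ℤ
inter-shift B h = filter (λ x → (x - h) ∈? B) B

module Submission where

-- Call y ∈ B a run start when y - h ∉ B, and let d be the number
-- of run starts, c = |B ∩ (B + h)|; then |B| = c + d.  Put k = ⌊1/α⌋.
-- Walking down from any x ∈ B in steps of h, either we stay inside B for k
-- steps, so that x - k·h, …, x is the wanted progression, or we meet a run
-- start y within fewer than k steps, so that x = y + i·h with i < k.  If the
-- second case happens for every x ∈ B, then B is covered by the k·d numbers
-- y + i·h, hence |B| ≤ k·d ≤ d/α.  But the hypothesis (1 - α)|B| < c says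
-- exactly that d < α|B|, a contradiction.

open import Defs
open import Data.Nat using (ℕ)
open import Data.Integer as ℤ using (ℤ; +_; _+_; _*_; _≤_)
open import Data.Rational as ℚ using (ℚ; 0ℚ; 1ℚ; _<_; _-_; _/_)
open import Data.List using (List; []; length)
open import Data.List.Relation.Unary.Unique.Propositional using (Unique)
open import Data.List.Membership.Propositional using (_∈_)
open import Data.Product using (Σ; _×_)
open import Relation.Binary.PropositionalEquality using (_≢_)

open import Level using (Level)
open import Function using (_∘_)
open import Data.Empty using (⊥-elim)
open import Data.Sum using (_⊎_; inj₁; inj₂)
open import Data.Product using (∃; _,_)
open import Data.Nat as ℕ using (suc; zero; NonZero; z≤n; s≤s)
import Data.Nat.Properties as ℕ
open import Data.Nat.DivMod using (m/n*n≤m)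
open import Data.Nat.Coprimality using (Coprime; 1-coprimeTo) renaming (sym to coprime-sym)
open import Data.Integer using (-[1+_]; +[1+_]; +0)
import Data.Integer.Properties as ℤ
open import Data.Integer.Tactic.RingSolver using (solve-∀)
open import Data.Rational using (mkℚ; toℚᵘ)
open import Data.Rational.Properties using (normalize-coprime; toℚᵘ-mono-<; toℚᵘ-homo-*; toℚᵘ-homo-+)
import Data.Rational.Unnormalised as ℚᵘ
import Data.Rational.Unnormalised.Properties as ℚᵘ
open import Data.List using (_∷_; _++_; filter; map)
open import Data.List.Properties using (filter-notAll; length-++; length-map)
open import Data.List.Membership.Propositional.Properties using (∈-filter⁺; ∈-map⁺; ∈-++⁺ˡ; ∈-++⁺ʳ)
open import Data.List.Membership.DecPropositional ℤ._≟_ using (_∈?_)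
open import Data.List.Relation.Unary.Any as Any using (here; there)
open import Data.List.Relation.Unary.All as All using ()
open import Data.List.Relation.Unary.AllPairs using (_∷_)
open import Relation.Binary.Definitions using (DecidableEquality)
open import Relation.Binary.PropositionalEquality using (_≡_; refl; sym; trans; cong; cong₂; subst; subst₂)
open import Relation.Nullary using (yes; no; ¬?)
open import Relation.Unary using (Pred; Decidable)
open import Relation.Unary.Properties using (∁?)

private
  variable
    a p : Level
    A : Set a

length-filter+filter-∁ : {P : Pred A p} (P? : Decidable P) (xs : List A) →
  length (filter P? xs) ℕ.+ length (filter (∁? P?) xs) ≡ length xs
length-filter+filter-∁ P? [] = refl
length-filter+filter-∁ P? (x ∷ xs) with P? x
... | yes _ = cong suc (length-filter+filter-∁ P? xs)
... | no _  = trans (ℕ.+-suc _ _) (cong suc (length-filter+filter-∁ P? xs))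

-- A duplicate-free list contained in ys is at most as long as ys: removing
-- its head x from ys strictly shortens ys and keeps the tail inside.
unique-⊆⇒length-≤ : (_≟_ : DecidableEquality A) {xs ys : List A} → Unique xs →
  (∀ {z} → z ∈ xs → z ∈ ys) → length xs ℕ.≤ length ys
unique-⊆⇒length-≤ _≟_ {[]} _ _ = z≤n
unique-⊆⇒length-≤ _≟_ {x ∷ xs} {ys} (x∉xs ∷ uniq) xs⊆ys =
  ℕ.≤-trans (s≤s (unique-⊆⇒length-≤ _≟_ uniq xs⊆ys-x)) ys-x<ys
  where
  ≢x? : Decidable (_≢ x)
  ≢x? z = ¬? (z ≟ x)
  xs⊆ys-x : ∀ {z} → z ∈ xs → z ∈ filter ≢x? ys
  xs⊆ys-x z∈xs = ∈-filter⁺ ≢x? (xs⊆ys (there z∈xs)) (All.lookup x∉xs z∈xs ∘ sym)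
  ys-x<ys : length (filter ≢x? ys) ℕ.< length ys
  ys-x<ys = filter-notAll ≢x? ys (Any.map (λ { refl z≢z → z≢z refl }) (xs⊆ys (here refl)))

all-or-witness : {P Q : A → Set p} (xs : List A) → (∀ {x} → x ∈ xs → P x ⊎ Q x) →
  (∀ {x} → x ∈ xs → P x) ⊎ ∃ Q
all-or-witness [] _ = inj₁ λ ()
all-or-witness (x ∷ xs) P⊎Q with P⊎Q (here refl) | all-or-witness xs (P⊎Q ∘ there)
... | inj₂ qx | _        = inj₂ (x , qx)
... | inj₁ _  | inj₂ wit = inj₂ wit
... | inj₁ px | inj₁ all = inj₁ λ { (here refl) → px ; (there x∈xs) → all x∈xs }

≤-quotient⇒scaled : ∀ m s .{{_ : NonZero s}} n d →
  n ℕ.≤ (m ℕ./ s) ℕ.* d → s ℕ.* n ℕ.≤ m ℕ.* d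
≤-quotient⇒scaled m s n d n≤kd = begin
  s ℕ.* n              ≤⟨ ℕ.*-monoʳ-≤ s n≤kd ⟩
  s ℕ.* (k ℕ.* d)      ≡⟨ sym (ℕ.*-assoc s k d) ⟩
  (s ℕ.* k) ℕ.* d      ≡⟨ cong (ℕ._* d) (ℕ.*-comm s k) ⟩
  (k ℕ.* s) ℕ.* d      ≤⟨ ℕ.*-monoˡ-≤ d (m/n*n≤m m s) ⟩
  m ℕ.* d              ∎
  where
  open ℕ.≤-Reasoning
  k = m ℕ./ s

ℕ/1≃ : ∀ n → toℚᵘ ((+ n) / 1) ℚᵘ.≃ ℚᵘ.mkℚᵘ (+ n) 0
ℕ/1≃ n = ℚᵘ.≃-reflexive (cong toℚᵘ (normalize-coprime {n} {0} (coprime-sym (1-coprimeTo n))))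

-- The density hypothesis with denominators cleared.  For α = (p+1)/(q+1)
-- and |B| = c + d, the inequality (1 - α)(c + d) < c says that d < α(c + d),
-- i.e. (q+1)·d < (p+1)·(c + d).
density-gap : ∀ p q .(cop : Coprime (suc p) (suc q)) c d →
  (1ℚ - mkℚ +[1+ p ] q cop) ℚ.* ((+ (c ℕ.+ d)) / 1) < (+ c) / 1 →
  suc q ℕ.* d ℕ.< suc p ℕ.* (c ℕ.+ d)
density-gap p q cop c d dense = ℕ.≰⇒> λ le →
  ℤ.<-irrefl (cleared-identity Q P C D) (ℤ.+-mono-<-≤ cleared (lift le))
  where
  α = mkℚ +[1+ p ] q cop
  Q = + suc q
  P = + suc p
  C = + c
  D = + d
  -- (1 - α)(C + D), multiplied through by the denominator q + 1.
  lhs : ℤ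
  lhs = ((+ 1 * Q + (ℤ.- P) * + 1) * (C + D)) * + 1
  cleared : lhs ℤ.< C * (Q * + 1 * + 1)
  cleared with ℚᵘ.<-respʳ-≃ (ℕ/1≃ c) (ℚᵘ.<-respˡ-≃ unnormalised (toℚᵘ-mono-< dense))
    where
    unnormalised : toℚᵘ ((1ℚ - α) ℚ.* ((+ (c ℕ.+ d)) / 1)) ℚᵘ.≃
                   (ℚᵘ.mkℚᵘ (+ 1) 0 ℚᵘ.+ ℚᵘ.mkℚᵘ -[1+ p ] q) ℚᵘ.* ℚᵘ.mkℚᵘ (+ (c ℕ.+ d)) 0
    unnormalised = ℚᵘ.≃-trans (toℚᵘ-homo-* (1ℚ - α) _)
                     (ℚᵘ.*-cong (toℚᵘ-homo-+ 1ℚ (ℚ.- α)) (ℕ/1≃ (c ℕ.+ d)))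
  ... | ℚᵘ.*<* lt = subst (λ z → lhs ℤ.< C * z) denominator lt
    where
    denominator : + (1 ℕ.* suc q ℕ.* 1) ≡ Q * + 1 * + 1
    denominator = trans (cong +_ (trans (ℕ.*-identityʳ (1 ℕ.* suc q)) (ℕ.*-identityˡ (suc q))))
                        (sym (trans (ℤ.*-identityʳ (Q * + 1)) (ℤ.*-identityʳ Q)))
  lift : suc p ℕ.* (c ℕ.+ d) ℕ.≤ suc q ℕ.* d → P * (C + D) ℤ.≤ Q * D
  lift le = subst₂ ℤ._≤_ (trans (ℤ.pos-* (suc p) _) (cong (P *_) (ℤ.pos-+ c d)))
                         (ℤ.pos-* (suc q) d) (ℤ.+≤+ le)
  cleared-identity : ∀ Q P C D →
    ((+ 1 * Q + (ℤ.- P) * + 1) * (C + D)) * + 1 + P * (C + D) ≡ C * (Q * + 1 * + 1) + Q * D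
  cleared-identity = solve-∀

floorInv-mkℚ : ∀ p q .(cop : Coprime (suc p) (suc q)) (0<α : 0ℚ < mkℚ +[1+ p ] q cop) →
  floorInv (mkℚ +[1+ p ] q cop) 0<α ≡ + (suc q ℕ./ suc p)
floorInv-mkℚ p q cop 0<α = ℤ.*-identityˡ _

module Runs (h : ℤ) (B : List ℤ) where

  starts : List ℤ
  starts = filter (∁? (λ y → (y ℤ.- h) ∈? B)) B

  overlap+starts : length (inter-shift B h) ℕ.+ length starts ≡ length B
  overlap+starts = length-filter+filter-∁ (λ y → (y ℤ.- h) ∈? B) B

  runs : ℕ → List ℤ
  runs zero    = []
  runs (suc n) = map (λ y → y + (+ n) * h) starts ++ runs n

  length-runs : ∀ n → length (runs n) ≡ n ℕ.* length starts
  length-runs zero    = refl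
  length-runs (suc n) = trans (length-++ (map _ starts))
                              (cong₂ ℕ._+_ (length-map _ starts) (length-runs n))

  BackwardRun : ℕ → ℤ → Set
  BackwardRun n x = ∀ j → j ℕ.≤ n → x ℤ.- (+ j) * h ∈ B

  Progression : ℕ → Set
  Progression n = Σ ℤ (λ b → b ∈ B × ((j : ℕ) → j ℕ.≤ n → b + (+ j) * h ∈ B))

  -- Walking down from x ∈ B for n steps either stays inside B, or passes a
  -- run start fewer than n steps below x, which puts x into runs n.
  descend : ∀ n {x} → x ∈ B → x ∈ runs n ⊎ BackwardRun n x
  descend zero {x} x∈B = inj₂ λ { zero _ → subst (_∈ B) (sym (minus-zero x h)) x∈B }
    where
    minus-zero : ∀ x h → x ℤ.- (+ 0) * h ≡ x
    minus-zero = solve-∀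
  descend (suc m) {x} x∈B with descend m x∈B
  ... | inj₁ x∈runs = inj₁ (∈-++⁺ʳ (map (λ y → y + (+ m) * h) starts) x∈runs)
  ... | inj₂ run with (x ℤ.- (+ suc m) * h) ∈? B
  ...   | yes next∈B = inj₂ λ j j≤1+m → extend j (ℕ.m≤n⇒m<n∨m≡n j≤1+m)
    where
    extend : ∀ j → j ℕ.< suc m ⊎ j ≡ suc m → x ℤ.- (+ j) * h ∈ B
    extend j (inj₁ j<1+m) = run j (ℕ.≤-pred j<1+m)
    extend j (inj₂ refl)  = next∈B
  ...   | no next∉B = inj₁ (subst (_∈ runs (suc m)) (cancel x (+ m) h)
                               (∈-++⁺ˡ (∈-map⁺ (λ y → y + (+ m) * h) start)))
    where
    cancel : ∀ x I h → (x ℤ.- I * h) + I * h ≡ x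
    cancel = solve-∀
    step : ∀ x I h → (x ℤ.- I * h) ℤ.- h ≡ x ℤ.- (+ 1 + I) * h
    step = solve-∀
    start : x ℤ.- (+ m) * h ∈ starts
    start = ∈-filter⁺ _ (run m ℕ.≤-refl) λ prev∈B →
      next∉B (subst (_∈ B) (trans (step x (+ m) h) (cong (λ t → x ℤ.- t * h) (sym (ℤ.pos-+ 1 m)))) prev∈B)

  run⇒progression : ∀ n {x} → BackwardRun n x → Progression n
  run⇒progression n {x} run = x ℤ.- (+ n) * h , run n ℕ.≤-refl ,
    λ j j≤n → subst (_∈ B) (shift j j≤n) (run (n ℕ.∸ j) (ℕ.m∸n≤m n j))
    where
    regroup : ∀ x J M h → (x ℤ.- (J + M) * h) + J * h ≡ x ℤ.- M * h
    regroup = solve-∀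
    shift : ∀ j → j ℕ.≤ n → x ℤ.- (+ (n ℕ.∸ j)) * h ≡ (x ℤ.- (+ n) * h) + (+ j) * h
    shift j j≤n = trans (sym (regroup x (+ j) (+ (n ℕ.∸ j)) h))
      (cong (λ t → (x ℤ.- t * h) + (+ j) * h)
            (trans (sym (ℤ.pos-+ j (n ℕ.∸ j))) (cong +_ (ℕ.m+[n∸m]≡n j≤n))))

  progression-or-covered : ∀ n → Progression n ⊎ (∀ {x} → x ∈ B → x ∈ runs n)
  progression-or-covered n with all-or-witness B (descend n)
  ... | inj₁ covered   = inj₂ covered
  ... | inj₂ (x , run) = inj₁ (run⇒progression n {x} run)

  covered⇒bound : ∀ n → Unique B → (∀ {x} → x ∈ B → x ∈ runs n) →
    length B ℕ.≤ n ℕ.* length starts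
  covered⇒bound n uniqueB covered =
    subst (length B ℕ.≤_) (length-runs n) (unique-⊆⇒length-≤ ℤ._≟_ uniqueB covered)

lemma5 : (α : ℚ) (0<α : 0ℚ < α) → α < 1ℚ → (h : ℤ) (B : List ℤ) →
           Unique B → B ≢ [] →
           (1ℚ - α) ℚ.* ((+ length B) / 1) < (+ length (inter-shift B h)) / 1 →
           Σ ℤ (λ b → b ∈ B × ((j : ℕ) → + j ≤ floorInv α 0<α → b + (+ j) * h ∈ B))
lemma5 (mkℚ +0 _ _)       (ℚ.*<* (ℤ.+<+ ())) _ _ _ _ _ _
lemma5 (mkℚ -[1+ _ ] _ _) (ℚ.*<* ())         _ _ _ _ _ _
lemma5 α@(mkℚ +[1+ p ] q cop) 0<α _ h B uniqueB _ dense
  with Runs.progression-or-covered h B (suc q ℕ./ suc p)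
... | inj₁ (b , b∈B , progression) = b , b∈B , λ j j≤⌊1/α⌋ →
  progression j (ℤ.drop‿+≤+ (subst (+ j ≤_) (floorInv-mkℚ p q cop 0<α) j≤⌊1/α⌋))
... | inj₂ covered = ⊥-elim (ℕ.<⇒≱ gap scaled)
  where
  open Runs h B
  k = suc q ℕ./ suc p
  c = length (inter-shift B h)
  d = length starts
  gap : suc q ℕ.* d ℕ.< suc p ℕ.* (c ℕ.+ d)
  gap = density-gap p q cop c d
          (subst (λ n → (1ℚ - α) ℚ.* ((+ n) / 1) < (+ c) / 1) (sym overlap+starts) dense)
  scaled : suc p ℕ.* (c ℕ.+ d) ℕ.≤ suc q ℕ.* d
  scaled = ≤-quotient⇒scaled (suc q) (suc p) (c ℕ.+ d) d
             (subst (ℕ._≤ k ℕ.* d) (sym overlap+starts) (covered⇒bound k uniqueB covered))
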